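{- $CT\equiv_{sW} C_{\omega^\omega}$, i.e. $CT\leq_{sW}C_{\omega^\omega}$ and $C_{\omega^\omega}\leq_{sW}CT$, where $CT$ and $C_{\omega^\omega}$ are the multivalued problems defined below.
   Context: A represented space is a pair $(X,d_X)$ with $d_X:\subseteq\omega^\omega\to X$ a partial surjection. For a multivalued $f:\subseteq X\rightrightarrows Y$, a function $F:\subseteq\omega^\omega\to\omega^\omega$ is a realizer of $f$ if $d_Y(F(p))\in f(d_X(p))$ for all $p\in d_X^{ -1}(\mathrm{dom}(f))$. For multivalued $f,g$ on represented spaces, $f\leq_{sW}g$ (strong Weihrauch reducibility) if there are computable $H,K:\subseteq\omega^\omega\to\omega^\omega$ such that $K\circ G\circ H$ is a realizer of $f$ for every realizer $G$ of $g$; $\equiv_{sW}$ means reducibility both ways. $C_{\omega^\omega}$ (closed choice on Baire space) takes a nonempty closed set $A\subseteq\omega^\omega$, given as (the characteristic function of) a tree $T\subseteq\omega^{<\omega}$ with $A=[T]$ the set of infinite paths, and returns some element of $A$. A Wang prototile is a 4-tuple $\langle l,u,r,b\rangle$ of colours (natural numbers) for the left, upper, right, bottom quarters of a diagonally quadrisected square; a total $S$-tiling is a map $f:\mathbb{Z}^2\to S$ with right colour of $f(x,y)$ = left colour of $f(x+1,y)$ and upper colour of $f(x,y)$ = bottom colour of $f(x,y+1)$ (no rotations). $CT$ (ChooseTiling) takes a set $S$ of Wang prototiles (given by its characteristic function on codes of tuples) that has a total $S$-tiling and returns some total $S$-tiling $f:\mathbb{Z}^2\to S$ (given as a sequence of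 tile codes). -}

module Defs where

open import Level using (Level; _⊔_; Lift; lift; lower) renaming (suc to lsuc; zero to lzero)
open import Data.Nat using (ℕ; zero; suc; _+_; _<_)
open import Data.Fin using (Fin)
open import Data.Vec using (Vec; []; _∷_; lookup)
open import Data.List using (List; []; _∷_; _++_; applyUpTo)
open import Data.Integer as ℤ using (ℤ; +_; -[1+_])
open import Data.Product using (Σ; ∃; _×_; _,_)
open import Data.Sum using (_⊎_)
open import Relation.Binary.PropositionalEquality using (_≡_)
open import Function.Bundles using (_⇔_)

Baire : Set
Baire = ℕ → ℕ

-- Oracle (relative) partial recursive functions: a syntax of codes and
-- a big-step evaluation relation  Eval α e xs y  ("Φ_e^α(xs) ↓ = y").

data PR : ℕ → Set where
  zer  : ∀ {n} → PR n
  succ : PR 1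
  proj : ∀ {n} → Fin n → PR n
  comp : ∀ {n m} → PR m → Vec (PR n) m → PR n
  prec : ∀ {n} → PR n → PR (suc (suc n)) → PR (suc n)
  mu   : ∀ {n} → PR (suc n) → PR n
  orc  : PR 1

mutual
  data Eval (α : Baire) : ∀ {n} → PR n → Vec ℕ n → ℕ → Set where
    ezer  : ∀ {n} {xs : Vec ℕ n} → Eval α zer xs 0
    esucc : ∀ {x} → Eval α succ (x ∷ []) (suc x)
    eproj : ∀ {n} {i : Fin n} {xs} → Eval α (proj i) xs (lookup xs i)
    ecomp : ∀ {n m} {f : PR m} {gs : Vec (PR n) m} {xs ys y} →
            EvalVec α gs xs ys → Eval α f ys y → Eval α (comp f gs) xs y
    eprec0 : ∀ {n} {g : PR n} {h} {xs y} →
             Eval α g xs y → Eval α (prec g h) (0 ∷ xs) y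
    eprecS : ∀ {n} {g : PR n} {h} {k xs z y} →
             Eval α (prec g h) (k ∷ xs) z → Eval α h (k ∷ z ∷ xs) y →
             Eval α (prec g h) (suc k ∷ xs) y
    emu   : ∀ {n} {f : PR (suc n)} {xs y} →
            Eval α f (y ∷ xs) 0 →
            (∀ z → z < y → Σ ℕ λ w → Eval α f (z ∷ xs) (suc w)) →
            Eval α (mu f) xs y
    eorc  : ∀ {x} → Eval α orc (x ∷ []) (α x)

  data EvalVec (α : Baire) {n : ℕ} : ∀ {m} → Vec (PR n) m → Vec ℕ n → Vec ℕ m → Set where
    enil  : ∀ {xs} → EvalVec α [] xs []
    econs : ∀ {m} {g : PR n} {gs : Vec (PR n) m} {xs y ys} →
            Eval α g xs y → EvalVec α gs xs ys → EvalVec α (g ∷ gs) xs (y ∷ ys)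

record PFun : Set₁ where
  field
    Dom : Baire → Set
    app : (p : Baire) → Dom p → Baire
open PFun public

Computable : PFun → Set
Computable F = Σ (PR 1) λ e → ∀ p (d : Dom F p) n → Eval p e (n ∷ []) (app F p d n)

_∘P_ : PFun → PFun → PFun
Dom (G ∘P F) p = Σ (Dom F p) λ d → Dom G (app F p d)
app (G ∘P F) p (d , d') = app G (app F p d) d'

record RepSpace (ℓ : Level) : Set (lsuc ℓ) where
  field
    Carrier : Set ℓ
    δ       : Baire → Carrier → Set
open RepSpace public

record Problem (ℓ ℓ' : Level) : Set (lsuc (ℓ ⊔ ℓ')) where
  field
    In   : RepSpace ℓ
    Out  : RepSpace ℓ'
    dom  : Carrier In → Set
    rel  : Carrier In → Carrier Out → Set
open Problem public

Realizer : ∀ {ℓ ℓ'} → Problem ℓ ℓ' → PFun → Set (ℓ ⊔ ℓ')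
Realizer f F =
  ∀ p x → δ (In f) p x → dom f x →
  Σ (Dom F p) λ d → Σ (Carrier (Out f)) λ y → δ (Out f) (app F p d) y × rel f x y

_≤sW_ : ∀ {ℓ₁ ℓ₂ ℓ₃ ℓ₄} → Problem ℓ₁ ℓ₂ → Problem ℓ₃ ℓ₄ → Set (lsuc lzero ⊔ ℓ₁ ⊔ ℓ₂ ⊔ ℓ₃ ⊔ ℓ₄)
f ≤sW g = Σ PFun λ H → Σ PFun λ K → Computable H × Computable K ×
          (∀ G → Realizer g G → Realizer f (K ∘P (G ∘P H)))

_≡sW_ : ∀ {ℓ₁ ℓ₂ ℓ₃ ℓ₄} → Problem ℓ₁ ℓ₂ → Problem ℓ₃ ℓ₄ → Set (lsuc lzero ⊔ ℓ₁ ⊔ ℓ₂ ⊔ ℓ₃ ⊔ ℓ₄)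
f ≡sW g = (f ≤sW g) × (g ≤sW f)

tri : ℕ → ℕ
tri zero    = 0
tri (suc n) = tri n + suc n

pair : ℕ → ℕ → ℕ
pair a b = tri (a + b) + b

-- coding of finite sequences ω^{<ω} → ℕ (a bijection)
code : List ℕ → ℕ
code []       = 0
code (a ∷ s)  = suc (pair a (code s))

prefix : Baire → ℕ → List ℕ
prefix x n = applyUpTo x n

codeℤ : ℤ → ℕ
codeℤ (+ n)      = n + n
codeℤ -[1+ n ]   = suc (n + n)

codeℤ² : ℤ → ℤ → ℕ
codeℤ² x y = pair (codeℤ x) (codeℤ y)

IsChar : Baire → Set
IsChar p = ∀ n → p n ≡ 0 ⊎ p n ≡ 1

BaireSpace : RepSpace lzero
Carrier BaireSpace = Baire
δ BaireSpace p x = ∀ n → p n ≡ x n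

-- Closed subsets of Baire space, represented by (characteristic functions
-- of) trees T ⊆ ω^{<ω} with A = [T].
IsTree : Baire → Set
IsTree p = IsChar p × (∀ s t → p (code (s ++ t)) ≡ 1 → p (code s) ≡ 1)

Path : Baire → Baire → Set
Path p x = ∀ n → p (code (prefix x n)) ≡ 1

ClosedSets : RepSpace (lsuc lzero)
Carrier ClosedSets = Baire → Set
δ ClosedSets p A = IsTree p × (∀ x → A x ⇔ Path p x)

C-Baire : Problem (lsuc lzero) lzero
In  C-Baire = ClosedSets
Out C-Baire = BaireSpace
dom C-Baire A = ∃ λ x → A x
rel C-Baire A x = A x

record Tile : Set where
  constructor ⟨_,_,_,_⟩
  field
    left up right bottom : ℕ
open Tile public

tileCode : Tile → ℕ
tileCode ⟨ l , u , r , b ⟩ = code (l ∷ u ∷ r ∷ b ∷ [])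

IsTiling : (Tile → Set) → (ℤ → ℤ → Tile) → Set
IsTiling S f =
  (∀ x y → S (f x y)) ×
  (∀ x y → right (f x y) ≡ left (f (ℤ.suc x) y)) ×
  (∀ x y → up (f x y) ≡ bottom (f x (ℤ.suc y)))

TileSets : RepSpace (lsuc lzero)
Carrier TileSets = Tile → Set
δ TileSets p S = IsChar p × (∀ t → S t ⇔ (p (tileCode t) ≡ 1))

Tilings : RepSpace lzero
Carrier Tilings = ℤ → ℤ → Tile
δ Tilings q f = ∀ x y → q (codeℤ² x y) ≡ tileCode (f x y)

CT : Problem (lsuc lzero) lzero
In  CT = TileSets
Out CT = Tilings
dom CT S = ∃ λ f → IsTiling S f
rel CT S f = IsTiling S f

module Submission where

-- CT ≤sW C-Baire: enumerate ℤ² through codeℤ².  A finite sequence belongs to the tree when each of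
-- its entries codes a tile of S that matches its right and upper neighbours whenever these are
-- listed as well.  This tree is decidable relative to the name of S, and its infinite paths are
-- exactly the names of total S-tilings, so the chosen path is itself the answer.
--
-- C-Baire ≤sW CT: from a tree T build the tiles ⟨⟨i , a⟩ , 0 , ⟨i + 1 , b⟩ , 0⟩ whose horizontal
-- colours carry a column index i ∈ ℤ and, in a column of index n ≥ 0, the reversed code a of a
-- sequence of length n in T, which b extends by one entry without leaving T; negative columns carry
-- the empty sequence.  Along any row the indices form a translate of ℤ, so the sequences met from
-- the column of index 0 onwards are the prefixes of one path through T, read off row 0.

open import Defs

open import Level using (_⊔_)
open import Data.Nat using (ℕ; zero; suc; _+_; _∸_; _<_; _≤_; pred; z≤n; s≤s; z<s)
open import Data.Nat.Properties
open import Data.Fin using (Fin) renaming (zero to fzero; suc to fsuc)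
open import Data.Vec using (Vec; []; _∷_; lookup; head; tail)
open import Data.List using ([]; _∷_; _++_; length; reverse; _ʳ++_)
open import Data.List.Properties using (length-++; length-applyUpTo; applyUpTo-∷ʳ; reverse-++; reverse-involutive)
open import Data.Integer as ℤ using (ℤ; +_; -[1+_]; 0ℤ; 1ℤ)
import Data.Integer.Properties as ℤₚ
open import Data.Integer.Tactic.RingSolver using (solve-∀)
open import Data.Unit using (⊤; tt)
open import Data.Product using (Σ; _×_; _,_; proj₁; proj₂)
open import Data.Sum using (_⊎_; inj₁; inj₂)
open import Data.Empty using (⊥-elim)
open import Function using (_∘_; id)
open import Function.Bundles using (mk⇔; Equivalence)
open import Relation.Binary.Definitions using (tri<; tri≈; tri>)
open import Relation.Binary.PropositionalEquality

-- A total map of the oracle and the arguments packaged with an oracle program computing it; every map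
-- below is assembled from these, so its computability holds by construction.
record CFun (n : ℕ) : Set where
  field
    fun     : Baire → Vec ℕ n → ℕ
    prog    : PR n
    correct : ∀ α xs → Eval α prog xs (fun α xs)
open CFun

run : CFun 1 → Baire → Baire
run c p n = fun c p (n ∷ [])

total : CFun 1 → PFun
Dom (total c) _ = ⊤
app (total c) p _ = run c p

total-computable : ∀ c → Computable (total c)
total-computable c = prog c , λ p _ n → correct c p (n ∷ [])

NameReduction : ∀ {ℓ₁ ℓ₂ ℓ₃ ℓ₄} → Problem ℓ₁ ℓ₂ → Problem ℓ₃ ℓ₄ → CFun 1 → CFun 1 → Set (ℓ₁ ⊔ ℓ₂ ⊔ ℓ₃ ⊔ ℓ₄)
NameReduction f g H K =
  ∀ p x → δ (In f) p x → dom f x →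
    Σ (Carrier (In g)) λ x′ → δ (In g) (run H p) x′ × dom g x′ ×
      (∀ q y′ → δ (Out g) q y′ → rel g x′ y′ →
         Σ (Carrier (Out f)) λ y → δ (Out f) (run K q) y × rel f x y)

sW-reduction : ∀ {ℓ₁ ℓ₂ ℓ₃ ℓ₄} (f : Problem ℓ₁ ℓ₂) (g : Problem ℓ₃ ℓ₄) (H K : CFun 1) →
               NameReduction f g H K → f ≤sW g
sW-reduction f g H K reduce = total H , total K , total-computable H , total-computable K , realizes
  where
  realizes : ∀ G → Realizer g G → Realizer f (total K ∘P (G ∘P total H))
  realizes G G-realizes p x p-names-x x∈dom with reduce p x p-names-x x∈dom
  ... | x′ , names , x′∈dom , back with G-realizes (run H p) x′ names x′∈dom
  ...   | d , y′ , q-names , y′∈g = ((tt , d) , tt) , back (app G (run H p) d) y′ q-names y′∈g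

cast : ∀ {n} (c : CFun n) (f : Baire → Vec ℕ n → ℕ) → (∀ α xs → fun c α xs ≡ f α xs) → CFun n
fun (cast c f eq) = f
prog (cast c f eq) = prog c
correct (cast c f eq) α xs = subst (Eval α (prog c) xs) (eq α xs) (correct c α xs)

cast₁ : (c : CFun 1) (f : Baire → ℕ → ℕ) → (∀ α x → fun c α (x ∷ []) ≡ f α x) → CFun 1
cast₁ c f eq = cast c (λ α xs → f α (head xs)) agrees
  where
  agrees : ∀ α xs → fun c α xs ≡ f α (head xs)
  agrees α (x ∷ []) = eq α x

cast₂ : (c : CFun 2) (f : Baire → ℕ → ℕ → ℕ) → (∀ α x y → fun c α (x ∷ y ∷ []) ≡ f α x y) → CFun 2
cast₂ c f eq = cast c (λ α xs → f α (head xs) (head (tail xs))) agrees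
  where
  agrees : ∀ α xs → fun c α xs ≡ f α (head xs) (head (tail xs))
  agrees α (x ∷ y ∷ []) = eq α x y

zeroᶜ : ∀ {n} → CFun n
fun zeroᶜ _ _ = 0
prog zeroᶜ = zer
correct zeroᶜ _ _ = ezer

sucᶜ : CFun 1
fun sucᶜ _ xs = suc (head xs)
prog sucᶜ = succ
correct sucᶜ _ (x ∷ []) = esucc

oracleᶜ : CFun 1
fun oracleᶜ α xs = α (head xs)
prog oracleᶜ = orc
correct oracleᶜ _ (x ∷ []) = eorc

projᶜ : ∀ {n} → Fin n → CFun n
fun (projᶜ i) _ xs = lookup xs i
prog (projᶜ i) = proj i
correct (projᶜ i) _ _ = eproj

funs : ∀ {n m} → Vec (CFun n) m → Baire → Vec ℕ n → Vec ℕ m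
funs [] α xs = []
funs (g ∷ gs) α xs = fun g α xs ∷ funs gs α xs

progs : ∀ {n m} → Vec (CFun n) m → Vec (PR n) m
progs [] = []
progs (g ∷ gs) = prog g ∷ progs gs

funs-correct : ∀ {n m} (gs : Vec (CFun n) m) α xs → EvalVec α (progs gs) xs (funs gs α xs)
funs-correct [] α xs = enil
funs-correct (g ∷ gs) α xs = econs (correct g α xs) (funs-correct gs α xs)

compᶜ : ∀ {n m} → CFun m → Vec (CFun n) m → CFun n
fun (compᶜ f gs) α xs = fun f α (funs gs α xs)
prog (compᶜ f gs) = comp (prog f) (progs gs)
correct (compᶜ f gs) α xs = ecomp (funs-correct gs α xs) (correct f α (funs gs α xs))

primrec : ∀ {n} → (Vec ℕ n → ℕ) → (Vec ℕ (suc (suc n)) → ℕ) → ℕ → Vec ℕ n → ℕ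
primrec g h zero xs = g xs
primrec g h (suc k) xs = h (k ∷ primrec g h k xs ∷ xs)

recᶜ : ∀ {n} → CFun n → CFun (suc (suc n)) → CFun (suc n)
fun (recᶜ g h) α xs = primrec (fun g α) (fun h α) (head xs) (tail xs)
prog (recᶜ g h) = prec (prog g) (prog h)
correct (recᶜ g h) α (k ∷ xs) = evaluates k
  where
  evaluates : ∀ k → Eval α (prec (prog g) (prog h)) (k ∷ xs) (primrec (fun g α) (fun h α) k xs)
  evaluates zero = eprec0 (correct g α xs)
  evaluates (suc k) = eprecS (evaluates k) (correct h α (k ∷ primrec (fun g α) (fun h α) k xs ∷ xs))

x₀ : ∀ {n} → CFun (suc n)
x₀ = projᶜ fzero

x₁ : ∀ {n} → CFun (suc (suc n))
x₁ = projᶜ (fsuc fzero)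

x₂ : ∀ {n} → CFun (suc (suc (suc n)))
x₂ = projᶜ (fsuc (fsuc fzero))

x₃ : ∀ {n} → CFun (suc (suc (suc (suc n))))
x₃ = projᶜ (fsuc (fsuc (fsuc fzero)))

ap₁ : ∀ {n} → CFun 1 → CFun n → CFun n
ap₁ f g = compᶜ f (g ∷ [])

ap₂ : ∀ {n} → CFun 2 → CFun n → CFun n → CFun n
ap₂ f g h = compᶜ f (g ∷ h ∷ [])

ap₃ : ∀ {n} → CFun 3 → CFun n → CFun n → CFun n → CFun n
ap₃ f g h i = compᶜ f (g ∷ h ∷ i ∷ [])

ifz : ℕ → ℕ → ℕ → ℕ
ifz zero    a b = a
ifz (suc _) a b = b

ifzᶜ : CFun 3
ifzᶜ = cast (recᶜ x₀ x₃) (λ _ xs → ifz (head xs) (head (tail xs)) (head (tail (tail xs)))) agrees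
  where
  agrees : ∀ α xs → fun (recᶜ x₀ x₃) α xs ≡ ifz (head xs) (head (tail xs)) (head (tail (tail xs)))
  agrees α (zero ∷ a ∷ b ∷ []) = refl
  agrees α (suc k ∷ a ∷ b ∷ []) = refl

ifᶜ : ∀ {n} → CFun n → CFun n → CFun n → CFun n
ifᶜ = ap₃ ifzᶜ

constᶜ : ∀ {n} → ℕ → CFun n
constᶜ {n} k = cast (numeral k) (λ _ _ → k) (numeral-value k)
  where
  numeral : ℕ → CFun n
  numeral zero = zeroᶜ
  numeral (suc k) = ap₁ sucᶜ (numeral k)
  numeral-value : ∀ k α xs → fun (numeral k) α xs ≡ k
  numeral-value zero α xs = refl
  numeral-value (suc k) α xs = cong suc (numeral-value k α xs)

predᶜ : CFun 1
predᶜ = cast₁ (recᶜ zeroᶜ x₀) (λ _ → pred) agrees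
  where
  agrees : ∀ α x → fun (recᶜ zeroᶜ x₀) α (x ∷ []) ≡ pred x
  agrees α zero = refl
  agrees α (suc x) = refl

addᶜ : CFun 2
addᶜ = cast₂ P (λ _ → _+_) agrees
  where
  P : CFun 2
  P = recᶜ x₀ (ap₁ sucᶜ x₁)
  agrees : ∀ α x y → fun P α (x ∷ y ∷ []) ≡ x + y
  agrees α zero y = refl
  agrees α (suc x) y = cong suc (agrees α x y)

monusᶜ : CFun 2
monusᶜ = cast₂ (ap₂ P x₁ x₀) (λ _ → _∸_) (λ α x y → agrees α y x)
  where
  P : CFun 2
  P = recᶜ x₀ (ap₁ predᶜ x₁)
  agrees : ∀ α y x → fun P α (y ∷ x ∷ []) ≡ x ∸ y
  agrees α zero x = refl
  agrees α (suc y) x = trans (cong pred (agrees α y x)) (pred[m∸n]≡m∸[1+n] x y)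

infixl 6 _+ᶜ_ _∸ᶜ_

_+ᶜ_ : ∀ {n} → CFun n → CFun n → CFun n
_+ᶜ_ = ap₂ addᶜ

_∸ᶜ_ : ∀ {n} → CFun n → CFun n → CFun n
_∸ᶜ_ = ap₂ monusᶜ

diagonal : ℕ → ℕ
diagonal zero = 0
diagonal (suc n) = ifz (tri (suc (diagonal n)) ∸ suc n) (suc (diagonal n)) (diagonal n)

unpair₂ : ℕ → ℕ
unpair₂ n = n ∸ tri (diagonal n)

unpair₁ : ℕ → ℕ
unpair₁ n = diagonal n ∸ unpair₂ n

OnDiagonal : ℕ → ℕ → Set
OnDiagonal d n = tri d ≤ n × n < tri (suc d)

on-diagonal : ∀ n → OnDiagonal (diagonal n) n
on-diagonal zero = z≤n , s≤s z≤n
on-diagonal (suc n) with on-diagonal n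
... | lo , hi with tri (suc (diagonal n)) ∸ suc n in eq
...   | zero  = m∸n≡0⇒m≤n eq , ≤-<-trans hi (m<m+n _ z<s)
...   | suc _ = m≤n⇒m≤1+n lo , m∸n≢0⇒n<m (λ eq₀ → 0≢1+n (trans (sym eq₀) eq))

tri-suc-mono : ∀ {d e} → d < e → tri (suc d) ≤ tri e
tri-suc-mono {d} {suc e} (s≤s d≤e) with m≤n⇒m<n∨m≡n d≤e
... | inj₂ refl = ≤-refl
... | inj₁ d<e  = ≤-trans (tri-suc-mono d<e) (m≤m+n (tri e) (suc e))

on-diagonal-unique : ∀ {d e n} → OnDiagonal d n → OnDiagonal e n → d ≡ e
on-diagonal-unique {d} {e} (lo , hi) (lo′ , hi′) with <-cmp d e
... | tri≈ _ d≡e _ = d≡e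
... | tri< d<e _ _ = ⊥-elim (<-irrefl refl (≤-<-trans (≤-trans (tri-suc-mono d<e) lo′) hi))
... | tri> _ _ e<d = ⊥-elim (<-irrefl refl (≤-<-trans (≤-trans (tri-suc-mono e<d) lo) hi′))

diagonal-pair : ∀ a b → diagonal (pair a b) ≡ a + b
diagonal-pair a b = on-diagonal-unique (on-diagonal (pair a b))
  (m≤m+n (tri (a + b)) b , +-monoʳ-< (tri (a + b)) (s≤s (m≤n+m b a)))

unpair₂-pair : ∀ a b → unpair₂ (pair a b) ≡ b
unpair₂-pair a b rewrite diagonal-pair a b = m+n∸m≡n (tri (a + b)) b

unpair₁-pair : ∀ a b → unpair₁ (pair a b) ≡ a
unpair₁-pair a b rewrite unpair₂-pair a b | diagonal-pair a b = m+n∸n≡m a b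

triᶜ : CFun 1
triᶜ = cast₁ P (λ _ → tri) agrees
  where
  P : CFun 1
  P = recᶜ zeroᶜ (x₁ +ᶜ ap₁ sucᶜ x₀)
  agrees : ∀ α k → fun P α (k ∷ []) ≡ tri k
  agrees α zero = refl
  agrees α (suc k) = cong (_+ suc k) (agrees α k)

diagonalᶜ : CFun 1
diagonalᶜ = cast₁ P (λ _ → diagonal) agrees
  where
  P : CFun 1
  P = recᶜ zeroᶜ (ifᶜ (ap₁ triᶜ (ap₁ sucᶜ x₁) ∸ᶜ ap₁ sucᶜ x₀) (ap₁ sucᶜ x₁) x₁)
  agrees : ∀ α k → fun P α (k ∷ []) ≡ diagonal k
  agrees α zero = refl
  agrees α (suc k) rewrite agrees α k = refl

pairᶜ : CFun 2
pairᶜ = cast₂ (ap₁ triᶜ (x₀ +ᶜ x₁) +ᶜ x₁) (λ _ → pair) (λ _ _ _ → refl)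

unpair₂ᶜ : CFun 1
unpair₂ᶜ = cast₁ (x₀ ∸ᶜ ap₁ triᶜ (ap₁ diagonalᶜ x₀)) (λ _ → unpair₂) (λ _ _ → refl)

unpair₁ᶜ : CFun 1
unpair₁ᶜ = cast₁ (ap₁ diagonalᶜ x₀ ∸ᶜ ap₁ unpair₂ᶜ x₀) (λ _ → unpair₁) (λ _ _ → refl)

Holds : ℕ → Set
Holds a = a ≢ 0

infixr 3 _∧ₙ_ _∧ᶜ_
infixr 2 _⇒ₙ_ _⇒ᶜ_
infix  4 _==_ _==ᶜ_

_∧ₙ_ : ℕ → ℕ → ℕ
a ∧ₙ b = ifz a 0 b

_⇒ₙ_ : ℕ → ℕ → ℕ
a ⇒ₙ b = ifz a 1 b

_==_ : ℕ → ℕ → ℕ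
a == b = ifz ((a ∸ b) + (b ∸ a)) 1 0

bool : ℕ → ℕ
bool a = ifz a 0 1

∧ₙ-intro : ∀ {a b} → Holds a → Holds b → Holds (a ∧ₙ b)
∧ₙ-intro {zero}  ha hb = ⊥-elim (ha refl)
∧ₙ-intro {suc a} ha hb = hb

∧ₙ-elimˡ : ∀ {a b} → Holds (a ∧ₙ b) → Holds a
∧ₙ-elimˡ {zero}  h = h
∧ₙ-elimˡ {suc a} h = λ ()

∧ₙ-elimʳ : ∀ {a b} → Holds (a ∧ₙ b) → Holds b
∧ₙ-elimʳ {zero}  h = ⊥-elim (h refl)
∧ₙ-elimʳ {suc a} h = h

⇒ₙ-intro : ∀ {a b} → (Holds a → Holds b) → Holds (a ⇒ₙ b)
⇒ₙ-intro {zero}  f = λ ()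
⇒ₙ-intro {suc a} f = f (λ ())

⇒ₙ-elim : ∀ {a b} → Holds (a ⇒ₙ b) → Holds a → Holds b
⇒ₙ-elim {zero}  h ha = ⊥-elim (ha refl)
⇒ₙ-elim {suc a} h ha = h

==-intro : ∀ {a b} → a ≡ b → Holds (a == b)
==-intro {a} refl rewrite n∸n≡0 a = λ ()

==-sound : ∀ {a b} → Holds (a == b) → a ≡ b
==-sound {a} {b} h with (a ∸ b) + (b ∸ a) in eq
... | zero  = ≤-antisym (m∸n≡0⇒m≤n (m+n≡0⇒m≡0 (a ∸ b) eq)) (m∸n≡0⇒m≤n (m+n≡0⇒n≡0 (a ∸ b) eq))
... | suc _ = ⊥-elim (h refl)

bool-char : ∀ a → bool a ≡ 0 ⊎ bool a ≡ 1
bool-char zero    = inj₁ refl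
bool-char (suc a) = inj₂ refl

bool≡1⇒holds : ∀ {a} → bool a ≡ 1 → Holds a
bool≡1⇒holds {suc a} _ = λ ()

holds⇒bool≡1 : ∀ {a} → Holds a → bool a ≡ 1
holds⇒bool≡1 {zero}  h = ⊥-elim (h refl)
holds⇒bool≡1 {suc a} h = refl

≡1⇒holds : ∀ {a} → a ≡ 1 → Holds a
≡1⇒holds refl = λ ()

holds⇒≡1 : ∀ {p : Baire} → IsChar p → ∀ v → Holds (p v) → p v ≡ 1
holds⇒≡1 p-char v h with p-char v
... | inj₁ eq = ⊥-elim (h eq)
... | inj₂ eq = eq

_∧ᶜ_ : ∀ {n} → CFun n → CFun n → CFun n
a ∧ᶜ b = ifᶜ a (constᶜ 0) b

_⇒ᶜ_ : ∀ {n} → CFun n → CFun n → CFun n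
a ⇒ᶜ b = ifᶜ a (constᶜ 1) b

_==ᶜ_ : ∀ {n} → CFun n → CFun n → CFun n
a ==ᶜ b = ifᶜ ((a ∸ᶜ b) +ᶜ (b ∸ᶜ a)) (constᶜ 1) (constᶜ 0)

boolᶜ : ∀ {n} → CFun n → CFun n
boolᶜ a = ifᶜ a (constᶜ 0) (constᶜ 1)

allBelow : (ℕ → ℕ) → ℕ → ℕ
allBelow P zero = 1
allBelow P (suc k) = allBelow P k ∧ₙ P k

allBelow-intro : ∀ P k → (∀ j → j < k → Holds (P j)) → Holds (allBelow P k)
allBelow-intro P zero h = λ ()
allBelow-intro P (suc k) h = ∧ₙ-intro (allBelow-intro P k (λ j j<k → h j (m<n⇒m<1+n j<k))) (h k ≤-refl)

allBelow-elim : ∀ P k → Holds (allBelow P k) → ∀ j → j < k → Holds (P j)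
allBelow-elim P (suc k) h j j<1+k with m<1+n⇒m<n∨m≡n j<1+k
... | inj₁ j<k  = allBelow-elim P k (∧ₙ-elimˡ h) j j<k
... | inj₂ refl = ∧ₙ-elimʳ {allBelow P k} h

allBelowᶜ : CFun 2 → CFun 2
allBelowᶜ P = cast₂ Q (λ α k c → allBelow (λ j → fun P α (j ∷ c ∷ [])) k) agrees
  where
  Q : CFun 2
  Q = recᶜ (constᶜ 1) (x₁ ∧ᶜ ap₂ P x₀ x₂)
  agrees : ∀ α k c → fun Q α (k ∷ c ∷ []) ≡ allBelow (λ j → fun P α (j ∷ c ∷ [])) k
  agrees α zero c = refl
  agrees α (suc k) c rewrite agrees α k c = refl

headCode : ℕ → ℕ
headCode c = unpair₁ (pred c)

tailCode : ℕ → ℕ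
tailCode c = unpair₂ (pred c)

headCode-code : ∀ a s → headCode (code (a ∷ s)) ≡ a
headCode-code a s = unpair₁-pair a (code s)

tailCode-code : ∀ a s → tailCode (code (a ∷ s)) ≡ code s
tailCode-code a s = unpair₂-pair a (code s)

length≤code : ∀ s → length s ≤ code s
length≤code [] = z≤n
length≤code (a ∷ s) = s≤s (≤-trans (length≤code s) (m≤n+m (code s) (tri (a + code s))))

iterate : (ℕ → ℕ) → ℕ → ℕ → ℕ
iterate f zero x = x
iterate f (suc k) x = f (iterate f k x)

iterate-suc : ∀ f k x → iterate f (suc k) x ≡ iterate f k (f x)
iterate-suc f zero x = refl
iterate-suc f (suc k) x = cong f (iterate-suc f k x)

tails-nil : ∀ k → iterate tailCode k 0 ≡ 0
tails-nil zero = refl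
tails-nil (suc k) = cong tailCode (tails-nil k)

tails-cons : ∀ a s k → iterate tailCode (suc k) (code (a ∷ s)) ≡ iterate tailCode k (code s)
tails-cons a s k = trans (iterate-suc tailCode k (code (a ∷ s))) (cong (iterate tailCode k) (tailCode-code a s))

headᶜ : CFun 1
headᶜ = cast₁ (ap₁ unpair₁ᶜ (ap₁ predᶜ x₀)) (λ _ → headCode) (λ _ _ → refl)

tailᶜ : CFun 1
tailᶜ = cast₁ (ap₁ unpair₂ᶜ (ap₁ predᶜ x₀)) (λ _ → tailCode) (λ _ _ → refl)

iterateᶜ : CFun 1 → CFun 2
iterateᶜ f = cast₂ P (λ α → iterate (λ y → fun f α (y ∷ []))) agrees
  where
  P : CFun 2
  P = recᶜ x₀ (ap₁ f x₁)
  agrees : ∀ α k x → fun P α (k ∷ x ∷ []) ≡ iterate (λ y → fun f α (y ∷ [])) k x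
  agrees α zero x = refl
  agrees α (suc k) x = cong (λ y → fun f α (y ∷ [])) (agrees α k x)

consCode : ℕ → ℕ → ℕ
consCode w a = suc (pair w a)

-- A state ⟨acc , rest⟩ moves the entries of rest onto acc one at a time; code s steps suffice since
-- length s ≤ code s.
reverseStep : ℕ → ℕ
reverseStep st = ifz (unpair₂ st) st (pair (consCode (headCode (unpair₂ st)) (unpair₁ st)) (tailCode (unpair₂ st)))

reverseCode : ℕ → ℕ
reverseCode c = unpair₁ (iterate reverseStep c (pair 0 c))

reverseStep-done : ∀ a k → iterate reverseStep k (pair a 0) ≡ pair a 0
reverseStep-done a zero = refl
reverseStep-done a (suc k) rewrite reverseStep-done a k | unpair₂-pair a 0 = refl

reverseStep-nonempty : ∀ st {a c} → unpair₁ st ≡ a → unpair₂ st ≡ suc c →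
                       reverseStep st ≡ pair (consCode (headCode (suc c)) a) (tailCode (suc c))
reverseStep-nonempty st fst≡a snd≡1+c rewrite snd≡1+c | fst≡a = refl

reverseStep-cons : ∀ acc x s → reverseStep (pair (code acc) (code (x ∷ s))) ≡ pair (code (x ∷ acc)) (code s)
reverseStep-cons acc x s =
  trans (reverseStep-nonempty (pair (code acc) (code (x ∷ s)))
                              (unpair₁-pair (code acc) (code (x ∷ s))) (unpair₂-pair (code acc) (code (x ∷ s))))
        (cong₂ (λ w rest → pair (consCode w (code acc)) rest) (headCode-code x s) (tailCode-code x s))

reverseStep-iterate : ∀ s acc k → length s ≤ k →
                      iterate reverseStep k (pair (code acc) (code s)) ≡ pair (code (s ʳ++ acc)) 0
reverseStep-iterate [] acc k _ = reverseStep-done (code acc) k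
reverseStep-iterate (x ∷ s) acc (suc k) (s≤s len≤k) = begin
  iterate reverseStep (suc k) (pair (code acc) (code (x ∷ s)))
    ≡⟨ iterate-suc reverseStep k _ ⟩
  iterate reverseStep k (reverseStep (pair (code acc) (code (x ∷ s))))
    ≡⟨ cong (iterate reverseStep k) (reverseStep-cons acc x s) ⟩
  iterate reverseStep k (pair (code (x ∷ acc)) (code s))
    ≡⟨ reverseStep-iterate s (x ∷ acc) k len≤k ⟩
  pair (code (s ʳ++ x ∷ acc)) 0
    ∎
  where open ≡-Reasoning

reverseCode-code : ∀ s → reverseCode (code s) ≡ code (reverse s)
reverseCode-code s = trans (cong unpair₁ (reverseStep-iterate s [] (code s) (length≤code s))) (unpair₁-pair _ 0)

consCodeᶜ : ∀ {n} → CFun n → CFun n → CFun n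
consCodeᶜ a s = ap₁ sucᶜ (ap₂ pairᶜ a s)

reverseStepᶜ : CFun 1
reverseStepᶜ = cast₁ (ifᶜ rest x₀ (ap₂ pairᶜ (consCodeᶜ (ap₁ headᶜ rest) (ap₁ unpair₁ᶜ x₀)) (ap₁ tailᶜ rest)))
                     (λ _ → reverseStep) (λ _ _ → refl)
  where
  rest : CFun 1
  rest = ap₁ unpair₂ᶜ x₀

reverseCodeᶜ : CFun 1
reverseCodeᶜ = cast₁ (ap₁ unpair₁ᶜ (ap₂ (iterateᶜ reverseStepᶜ) x₀ (ap₂ pairᶜ (constᶜ 0) x₀)))
                     (λ _ → reverseCode) (λ _ _ → refl)

reverse-prefix-suc : ∀ (y : Baire) n → reverse (prefix y (suc n)) ≡ y n ∷ reverse (prefix y n)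
reverse-prefix-suc y n = trans (cong reverse (sym (applyUpTo-∷ʳ y n))) (reverse-++ (prefix y n) (y n ∷ []))

consCode-history : ∀ (y : Baire) (A : ℕ → ℕ) → A 0 ≡ 0 → (∀ n → A (suc n) ≡ consCode (y n) (A n)) →
                   ∀ n → A n ≡ code (reverse (prefix y n))
consCode-history y A A-zero A-suc zero = A-zero
consCode-history y A A-zero A-suc (suc n) = begin
  A (suc n)                                     ≡⟨ A-suc n ⟩
  consCode (y n) (A n)                          ≡⟨ cong (consCode (y n)) (consCode-history y A A-zero A-suc n) ⟩
  code (y n ∷ reverse (prefix y n))             ≡⟨ cong code (sym (reverse-prefix-suc y n)) ⟩
  code (reverse (prefix y (suc n)))             ∎
  where open ≡-Reasoning

reverseCode-reversed-prefix : ∀ (y : Baire) n → reverseCode (code (reverse (prefix y n))) ≡ code (prefix y n)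
reverseCode-reversed-prefix y n =
  trans (reverseCode-code (reverse (prefix y n))) (cong code (reverse-involutive (prefix y n)))

entry : ℕ → ℕ → ℕ
entry c j = headCode (iterate tailCode j c)

entry-cons-suc : ∀ a s j → entry (code (a ∷ s)) (suc j) ≡ entry (code s) j
entry-cons-suc a s j = cong headCode (tails-cons a s j)

tails-holds⇒< : ∀ s k → Holds (iterate tailCode k (code s)) → k < length s
tails-holds⇒< [] k h = ⊥-elim (h (tails-nil k))
tails-holds⇒< (a ∷ s) zero h = s≤s z≤n
tails-holds⇒< (a ∷ s) (suc k) h = s≤s (tails-holds⇒< s k (subst Holds (tails-cons a s k) h))

<⇒tails-holds : ∀ s k → k < length s → Holds (iterate tailCode k (code s))
<⇒tails-holds (a ∷ s) zero _ = λ ()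
<⇒tails-holds (a ∷ s) (suc k) (s≤s k<n) = subst Holds (sym (tails-cons a s k)) (<⇒tails-holds s k k<n)

entry-++ : ∀ s t j → j < length s → entry (code (s ++ t)) j ≡ entry (code s) j
entry-++ (a ∷ s) t zero _ = trans (headCode-code a (s ++ t)) (sym (headCode-code a s))
entry-++ (a ∷ s) t (suc j) (s≤s j<n) = begin
  entry (code (a ∷ s ++ t)) (suc j)  ≡⟨ entry-cons-suc a (s ++ t) j ⟩
  entry (code (s ++ t)) j            ≡⟨ entry-++ s t j j<n ⟩
  entry (code s) j                   ≡⟨ sym (entry-cons-suc a s j) ⟩
  entry (code (a ∷ s)) (suc j)       ∎
  where open ≡-Reasoning

entry-prefix : ∀ (y : Baire) n j → j < n → entry (code (prefix y n)) j ≡ y j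
entry-prefix y (suc n) zero _ = headCode-code (y 0) (prefix (y ∘ suc) n)
entry-prefix y (suc n) (suc j) (s≤s j<n) =
  trans (entry-cons-suc (y 0) (prefix (y ∘ suc) n) j) (entry-prefix (y ∘ suc) n j j<n)

tailsᶜ : ∀ {n} → CFun n → CFun n → CFun n
tailsᶜ k c = ap₂ (iterateᶜ tailᶜ) k c

entryᶜ : ∀ {n} → CFun n → CFun n → CFun n
entryᶜ c j = ap₁ headᶜ (tailsᶜ j c)

parity : ℕ → ℕ
parity zero = 0
parity (suc k) = ifz (parity k) 1 0

half : ℕ → ℕ
half zero = 0
half (suc k) = half k + parity k

signed : ℕ → ℕ → ℤ
signed zero    h = + h
signed (suc _) h = -[1+ h ]

decodeℤ : ℕ → ℤ
decodeℤ c = signed (parity c) (half c)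

sucCode : ℕ → ℕ
sucCode c = ifz (parity c) (suc (suc c)) (c ∸ 2)

Even : ℕ → Set
Even c = parity c ≡ 0 × c ≡ half c + half c

Odd : ℕ → Set
Odd c = parity c ≡ 1 × c ≡ suc (half c + half c)

even-or-odd : ∀ c → Even c ⊎ Odd c
even-or-odd zero = inj₁ (refl , refl)
even-or-odd (suc c) with even-or-odd c
... | inj₁ (p , e) rewrite p = inj₂ (refl , cong suc (trans e (cong (λ h → h + h) (sym (+-identityʳ (half c))))))
... | inj₂ (p , e) rewrite p = inj₁ (refl , (begin
  suc c                               ≡⟨ cong suc e ⟩
  suc (suc (half c + half c))         ≡⟨ cong suc (sym (+-suc (half c) (half c))) ⟩
  suc (half c) + suc (half c)         ≡⟨ cong (λ h → h + h) (+-comm 1 (half c)) ⟩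
  (half c + 1) + (half c + 1)         ∎))
  where open ≡-Reasoning

double-even : ∀ n → parity (n + n) ≡ 0 × half (n + n) ≡ n
double-even zero = refl , refl
double-even (suc n) rewrite +-suc n n with double-even n
... | p , h rewrite p | h = refl , trans (+-comm (n + 0) 1) (cong suc (+-identityʳ n))

double-odd : ∀ n → parity (suc (n + n)) ≡ 1 × half (suc (n + n)) ≡ n
double-odd n rewrite proj₁ (double-even n) | proj₂ (double-even n) = refl , +-identityʳ n

codeℤ-decodeℤ : ∀ c → codeℤ (decodeℤ c) ≡ c
codeℤ-decodeℤ c with even-or-odd c
... | inj₁ (p , e) rewrite p = sym e
... | inj₂ (p , e) rewrite p = sym e

decodeℤ-codeℤ : ∀ z → decodeℤ (codeℤ z) ≡ z
decodeℤ-codeℤ (+ n) rewrite proj₁ (double-even n) | proj₂ (double-even n) = refl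
decodeℤ-codeℤ -[1+ n ] rewrite proj₁ (double-odd n) | proj₂ (double-odd n) = refl

sucCode-codeℤ : ∀ z → sucCode (codeℤ z) ≡ codeℤ (ℤ.suc z)
sucCode-codeℤ (+ n) rewrite proj₁ (double-even n) = cong suc (sym (+-suc n n))
sucCode-codeℤ -[1+ zero ] = refl
sucCode-codeℤ -[1+ suc k ] rewrite proj₁ (double-odd (suc k)) = +-suc k k

decodeℤ-sucCode : ∀ c → decodeℤ (sucCode c) ≡ ℤ.suc (decodeℤ c)
decodeℤ-sucCode c = begin
  decodeℤ (sucCode c)                    ≡⟨ cong (decodeℤ ∘ sucCode) (sym (codeℤ-decodeℤ c)) ⟩
  decodeℤ (sucCode (codeℤ (decodeℤ c)))  ≡⟨ cong decodeℤ (sucCode-codeℤ (decodeℤ c)) ⟩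
  decodeℤ (codeℤ (ℤ.suc (decodeℤ c)))    ≡⟨ decodeℤ-codeℤ (ℤ.suc (decodeℤ c)) ⟩
  ℤ.suc (decodeℤ c)                      ∎
  where open ≡-Reasoning

parityᶜ : CFun 1
parityᶜ = cast₁ P (λ _ → parity) agrees
  where
  P : CFun 1
  P = recᶜ zeroᶜ (ifᶜ x₁ (constᶜ 1) (constᶜ 0))
  agrees : ∀ α k → fun P α (k ∷ []) ≡ parity k
  agrees α zero = refl
  agrees α (suc k) rewrite agrees α k = refl

halfᶜ : CFun 1
halfᶜ = cast₁ P (λ _ → half) agrees
  where
  P : CFun 1
  P = recᶜ zeroᶜ (x₁ +ᶜ ap₁ parityᶜ x₀)
  agrees : ∀ α k → fun P α (k ∷ []) ≡ half k
  agrees α zero = refl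
  agrees α (suc k) rewrite agrees α k = refl

sucCodeᶜ : CFun 1
sucCodeᶜ = cast₁ (ifᶜ (ap₁ parityᶜ x₀) (ap₁ sucᶜ (ap₁ sucᶜ x₀)) (x₀ ∸ᶜ constᶜ 2))
                 (λ _ → sucCode) (λ _ _ → refl)

codeℤ⊖ : ℕ → ℕ → ℕ
codeℤ⊖ m n = ifz (n ∸ m) ((m ∸ n) + (m ∸ n)) (suc ((n ∸ suc m) + (n ∸ suc m)))

codeℤ⊖-correct : ∀ m n → codeℤ⊖ m n ≡ codeℤ (m ℤ.⊖ n)
codeℤ⊖-correct m n with n ∸ m in eq
... | zero  = cong codeℤ (sym (ℤₚ.⊖-≥ {m} {n} (m∸n≡0⇒m≤n eq)))
... | suc k = begin
  suc ((n ∸ suc m) + (n ∸ suc m))  ≡⟨ cong (λ d → suc (d + d)) n∸1+m≡k ⟩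
  codeℤ (ℤ.- (+ suc k))            ≡⟨ cong (λ d → codeℤ (ℤ.- (+ d))) (sym eq) ⟩
  codeℤ (ℤ.- (+ (n ∸ m)))          ≡⟨ cong codeℤ (sym (ℤₚ.⊖-< {m} {n} m<n)) ⟩
  codeℤ (m ℤ.⊖ n)                  ∎
  where
  open ≡-Reasoning
  m<n : m < n
  m<n = m∸n≢0⇒n<m (λ n∸m≡0 → 0≢1+n (trans (sym n∸m≡0) eq))
  n∸1+m≡k : n ∸ suc m ≡ k
  n∸1+m≡k = trans (sym (pred[m∸n]≡m∸[1+n] n m)) (cong pred eq)

offsetCode : ℕ → ℕ → ℕ
offsetCode c n = ifz (parity c) (codeℤ⊖ n (half c)) ((n + suc (half c)) + (n + suc (half c)))

offsetCode-correct : ∀ c n → offsetCode c n ≡ codeℤ (+ n ℤ.- decodeℤ c)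
offsetCode-correct c n with even-or-odd c
... | inj₁ (par , _) rewrite par = trans (codeℤ⊖-correct n (half c)) (cong codeℤ (sym (ℤₚ.m-n≡m⊖n n (half c))))
... | inj₂ (par , _) rewrite par = refl

codeℤ⊖ᶜ : ∀ {n} → CFun n → CFun n → CFun n
codeℤ⊖ᶜ m k = ifᶜ (k ∸ᶜ m) ((m ∸ᶜ k) +ᶜ (m ∸ᶜ k)) (ap₁ sucᶜ ((k ∸ᶜ ap₁ sucᶜ m) +ᶜ (k ∸ᶜ ap₁ sucᶜ m)))

offsetCodeᶜ : ∀ {n} → CFun n → CFun n → CFun n
offsetCodeᶜ c n = ifᶜ (ap₁ parityᶜ c) (codeℤ⊖ᶜ n (ap₁ halfᶜ c))
                      ((n +ᶜ ap₁ sucᶜ (ap₁ halfᶜ c)) +ᶜ (n +ᶜ ap₁ sucᶜ (ap₁ halfᶜ c)))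

+-cancel-sub : ∀ i j → i ℤ.+ (j ℤ.- i) ≡ j
+-cancel-sub = solve-∀

+-pred-cancel-sub : ∀ i → i ℤ.+ (ℤ.-1ℤ ℤ.+ (0ℤ ℤ.- i)) ≡ ℤ.-1ℤ
+-pred-cancel-sub = solve-∀

+-suc-comm : ∀ i j → 1ℤ ℤ.+ (i ℤ.+ j) ≡ i ℤ.+ (1ℤ ℤ.+ j)
+-suc-comm = solve-∀

suc-equivariant⇒translation : (I : ℤ → ℤ) → (∀ x → I (ℤ.suc x) ≡ ℤ.suc (I x)) → ∀ x → I x ≡ I 0ℤ ℤ.+ x
suc-equivariant⇒translation I I-suc = translate
  where
  open ≡-Reasoning
  step-down : ∀ x → I (ℤ.suc x) ≡ I 0ℤ ℤ.+ ℤ.suc x → I x ≡ I 0ℤ ℤ.+ x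
  step-down x hyp = begin
    I x                             ≡⟨ sym (ℤₚ.pred-suc (I x)) ⟩
    ℤ.pred (ℤ.suc (I x))            ≡⟨ cong ℤ.pred (sym (I-suc x)) ⟩
    ℤ.pred (I (ℤ.suc x))            ≡⟨ cong ℤ.pred hyp ⟩
    ℤ.pred (I 0ℤ ℤ.+ ℤ.suc x)       ≡⟨ sym (ℤₚ.+-pred (I 0ℤ) (ℤ.suc x)) ⟩
    I 0ℤ ℤ.+ ℤ.pred (ℤ.suc x)       ≡⟨ cong (λ k → I 0ℤ ℤ.+ k) (ℤₚ.pred-suc x) ⟩
    I 0ℤ ℤ.+ x                      ∎
  translate : ∀ x → I x ≡ I 0ℤ ℤ.+ x
  translate (+ zero) = sym (ℤₚ.+-identityʳ (I 0ℤ))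
  translate (+ suc n) = begin
    I (ℤ.suc (+ n))             ≡⟨ I-suc (+ n) ⟩
    ℤ.suc (I (+ n))             ≡⟨ cong ℤ.suc (translate (+ n)) ⟩
    ℤ.suc (I 0ℤ ℤ.+ + n)        ≡⟨ +-suc-comm (I 0ℤ) (+ n) ⟩
    I 0ℤ ℤ.+ + suc n            ∎
  translate -[1+ zero ]  = step-down -[1+ zero ] (translate (+ zero))
  translate -[1+ suc n ] = step-down -[1+ suc n ] (translate -[1+ n ])

decodeTile : ℕ → Tile
decodeTile v = ⟨ headCode v , headCode (tailCode v) , headCode (tailCode (tailCode v))
                , headCode (tailCode (tailCode (tailCode v))) ⟩

decodeTile-tileCode : ∀ t → decodeTile (tileCode t) ≡ t
decodeTile-tileCode ⟨ l , u , r , b ⟩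
  rewrite headCode-code l (u ∷ r ∷ b ∷ []) | tailCode-code l (u ∷ r ∷ b ∷ [])
        | headCode-code u (r ∷ b ∷ []) | tailCode-code u (r ∷ b ∷ [])
        | headCode-code r (b ∷ []) | tailCode-code r (b ∷ []) | headCode-code b [] = refl

tileCodeᶜ : ∀ {n} → CFun n → CFun n → CFun n → CFun n → CFun n
tileCodeᶜ l u r b = consCodeᶜ l (consCodeᶜ u (consCodeᶜ r (consCodeᶜ b (constᶜ 0))))

leftᶜ upᶜ rightᶜ bottomᶜ : ∀ {n} → CFun n → CFun n
leftᶜ v = ap₁ headᶜ v
upᶜ v = ap₁ headᶜ (ap₁ tailᶜ v)
rightᶜ v = ap₁ headᶜ (ap₁ tailᶜ (ap₁ tailᶜ v))
bottomᶜ v = ap₁ headᶜ (ap₁ tailᶜ (ap₁ tailᶜ (ap₁ tailᶜ v)))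

names⇒decodeTile : ∀ q g → δ Tilings q g → ∀ x z → decodeTile (q (codeℤ² x z)) ≡ g x z
names⇒decodeTile q g q-names-g x z = trans (cong decodeTile (q-names-g x z)) (decodeTile-tileCode (g x z))

column row : ℕ → ℤ
column j = decodeℤ (unpair₁ j)
row j = decodeℤ (unpair₂ j)

rightCell upCell : ℕ → ℕ
rightCell j = pair (sucCode (unpair₁ j)) (unpair₂ j)
upCell j = pair (unpair₁ j) (sucCode (unpair₂ j))

column-rightCell : ∀ j → column (rightCell j) ≡ ℤ.suc (column j)
column-rightCell j =
  trans (cong decodeℤ (unpair₁-pair (sucCode (unpair₁ j)) (unpair₂ j))) (decodeℤ-sucCode (unpair₁ j))

row-rightCell : ∀ j → row (rightCell j) ≡ row j
row-rightCell j = cong decodeℤ (unpair₂-pair (sucCode (unpair₁ j)) (unpair₂ j))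

column-upCell : ∀ j → column (upCell j) ≡ column j
column-upCell j = cong decodeℤ (unpair₁-pair (unpair₁ j) (sucCode (unpair₂ j)))

row-upCell : ∀ j → row (upCell j) ≡ ℤ.suc (row j)
row-upCell j =
  trans (cong decodeℤ (unpair₂-pair (unpair₁ j) (sucCode (unpair₂ j)))) (decodeℤ-sucCode (unpair₂ j))

rightCell-codeℤ² : ∀ x y → rightCell (codeℤ² x y) ≡ codeℤ² (ℤ.suc x) y
rightCell-codeℤ² x y
  rewrite unpair₁-pair (codeℤ x) (codeℤ y) | unpair₂-pair (codeℤ x) (codeℤ y) | sucCode-codeℤ x = refl

upCell-codeℤ² : ∀ x y → upCell (codeℤ² x y) ≡ codeℤ² x (ℤ.suc y)
upCell-codeℤ² x y
  rewrite unpair₁-pair (codeℤ x) (codeℤ y) | unpair₂-pair (codeℤ x) (codeℤ y) | sucCode-codeℤ y = refl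

rightCellᶜ upCellᶜ : ∀ {n} → CFun n → CFun n
rightCellᶜ j = ap₂ pairᶜ (ap₁ sucCodeᶜ (ap₁ unpair₁ᶜ j)) (ap₁ unpair₂ᶜ j)
upCellᶜ j = ap₂ pairᶜ (ap₁ unpair₁ᶜ j) (ap₁ sucCodeᶜ (ap₁ unpair₂ᶜ j))

-- CT reduces to closed choice

admissible : Baire → ℕ → ℕ
admissible p v = (v == tileCode (decodeTile v)) ∧ₙ p v

Admissible : Baire → ℕ → Set
Admissible p v = Holds (admissible p v)

HMatch VMatch : (ℕ → ℕ) → ℕ → Set
HMatch y j = right (decodeTile (y j)) ≡ left (decodeTile (y (rightCell j)))
VMatch y j = up (decodeTile (y j)) ≡ bottom (decodeTile (y (upCell j)))

ConsistentAt : Baire → (ℕ → ℕ) → (ℕ → Set) → ℕ → Set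
ConsistentAt p y Present j =
  Admissible p (y j) × (Present (rightCell j) → HMatch y j) × (Present (upCell j) → VMatch y j)

ConsistentBelow : Baire → (ℕ → ℕ) → ℕ → Set
ConsistentBelow p y n = ∀ j → j < n → ConsistentAt p y (_< n) j

LocallyTiled : Baire → (ℕ → ℕ) → Set
LocallyTiled p y = ∀ j → Admissible p (y j) × HMatch y j × VMatch y j

consistentBelow-restrict : ∀ p {y z m n} → m ≤ n → (∀ j → j < m → y j ≡ z j) →
                           ConsistentBelow p y n → ConsistentBelow p z m
consistentBelow-restrict p {y} {z} m≤n y≡z cons j j<m with cons j (<-≤-trans j<m m≤n)
... | adm , hm , vm =
  subst (Admissible p) (y≡z j j<m) adm ,
  (λ r<m → trans (cong (right ∘ decodeTile) (sym (y≡z j j<m)))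
                 (trans (hm (<-≤-trans r<m m≤n)) (cong (left ∘ decodeTile) (y≡z (rightCell j) r<m)))) ,
  (λ u<m → trans (cong (up ∘ decodeTile) (sym (y≡z j j<m)))
                 (trans (vm (<-≤-trans u<m m≤n)) (cong (bottom ∘ decodeTile) (y≡z (upCell j) u<m))))

locallyTiled⇒consistentBelow : ∀ p {y} → LocallyTiled p y → ∀ n → ConsistentBelow p y n
locallyTiled⇒consistentBelow p tiled n j _ with tiled j
... | adm , hm , vm = adm , (λ _ → hm) , (λ _ → vm)

consistentBelow⇒locallyTiled : ∀ p {y} → (∀ n → ConsistentBelow p y n) → LocallyTiled p y
consistentBelow⇒locallyTiled p cons j with cons (suc (j + (rightCell j + upCell j))) j (s≤s (m≤m+n j _))
... | adm , hm , vm = adm , hm (s≤s (≤-trans (m≤m+n (rightCell j) (upCell j)) (m≤n+m _ j)))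
                         , vm (s≤s (≤-trans (m≤n+m (upCell j) (rightCell j)) (m≤n+m _ j)))

module TilingChecker (p : Baire) (c : ℕ) where

  present : ℕ → ℕ
  present k = iterate tailCode k c

  hmatch vmatch : ℕ → ℕ
  hmatch j = right (decodeTile (entry c j)) == left (decodeTile (entry c (rightCell j)))
  vmatch j = up (decodeTile (entry c j)) == bottom (decodeTile (entry c (upCell j)))

  cellConditions : ℕ → ℕ
  cellConditions j = admissible p (entry c j) ∧ₙ (present (rightCell j) ⇒ₙ hmatch j) ∧ₙ (present (upCell j) ⇒ₙ vmatch j)

  cellCheck : ℕ → ℕ
  cellCheck j = present j ⇒ₙ cellConditions j

open TilingChecker using (cellCheck)

-- Quantifying over j below the code c itself suffices, as length s ≤ code s.
partialTilings : Baire → ℕ → ℕ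
partialTilings p c = bool (allBelow (cellCheck p c) c)

cellCheck-sound : ∀ p s j → Holds (cellCheck p (code s) j) → j < length s →
                  ConsistentAt p (entry (code s)) (_< length s) j
cellCheck-sound p s j h j<n =
  ∧ₙ-elimˡ conj ,
  (λ r<n → ==-sound (⇒ₙ-elim (∧ₙ-elimˡ (∧ₙ-elimʳ {admissible p (entry c j)} conj)) (<⇒tails-holds s _ r<n))) ,
  (λ u<n → ==-sound (⇒ₙ-elim (∧ₙ-elimʳ {present (rightCell j) ⇒ₙ hmatch j}
                                         (∧ₙ-elimʳ {admissible p (entry c j)} conj))
                              (<⇒tails-holds s _ u<n)))
  where
  c : ℕ
  c = code s
  open TilingChecker p c
  conj : Holds (cellConditions j)
  conj = ⇒ₙ-elim h (<⇒tails-holds s j j<n)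

cellCheck-complete : ∀ p s j → (j < length s → ConsistentAt p (entry (code s)) (_< length s) j) →
                     Holds (cellCheck p (code s) j)
cellCheck-complete p s j ok = ⇒ₙ-intro λ pj → cell (ok (tails-holds⇒< s j pj))
  where
  open TilingChecker p (code s)
  cell : ConsistentAt p (entry (code s)) (_< length s) j → Holds (cellConditions j)
  cell (adm , hm , vm) = ∧ₙ-intro adm (∧ₙ-intro
    (⇒ₙ-intro λ pr → ==-intro (hm (tails-holds⇒< s _ pr)))
    (⇒ₙ-intro λ pu → ==-intro (vm (tails-holds⇒< s _ pu))))

partialTilings-sound : ∀ p s → partialTilings p (code s) ≡ 1 → ConsistentBelow p (entry (code s)) (length s)
partialTilings-sound p s eq j j<n =
  cellCheck-sound p s j (allBelow-elim (cellCheck p (code s)) (code s) (bool≡1⇒holds eq) j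
                          (<-≤-trans j<n (length≤code s))) j<n

partialTilings-complete : ∀ p s → ConsistentBelow p (entry (code s)) (length s) → partialTilings p (code s) ≡ 1
partialTilings-complete p s cons =
  holds⇒bool≡1 (allBelow-intro (cellCheck p (code s)) (code s) (λ j _ → cellCheck-complete p s j (cons j)))

partialTilings-tree : ∀ p → IsTree (partialTilings p)
partialTilings-tree p = (λ n → bool-char (allBelow (cellCheck p n) n)) , prefix-closed
  where
  prefix-closed : ∀ s t → partialTilings p (code (s ++ t)) ≡ 1 → partialTilings p (code s) ≡ 1
  prefix-closed s t eq = partialTilings-complete p s
    (consistentBelow-restrict p (subst (length s ≤_) (sym (length-++ s)) (m≤m+n _ _))
      (λ j j<n → entry-++ s t j j<n) (partialTilings-sound p (s ++ t) eq))

path⇒locallyTiled : ∀ p y → Path (partialTilings p) y → LocallyTiled p y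
path⇒locallyTiled p y path = consistentBelow⇒locallyTiled p λ n →
  consistentBelow-restrict p (≤-reflexive (sym (length-applyUpTo y n))) (entry-prefix y n)
    (partialTilings-sound p (prefix y n) (path n))

locallyTiled⇒path : ∀ p y → LocallyTiled p y → Path (partialTilings p) y
locallyTiled⇒path p y tiled n = partialTilings-complete p (prefix y n)
  (consistentBelow-restrict p (≤-reflexive (length-applyUpTo y n))
    (λ j j<n → sym (entry-prefix y n j (subst (j <_) (length-applyUpTo y n) j<n)))
    (locallyTiled⇒consistentBelow p tiled n))

admissibleᶜ : CFun 1
admissibleᶜ = cast₁ ((x₀ ==ᶜ tileCodeᶜ (leftᶜ x₀) (upᶜ x₀) (rightᶜ x₀) (bottomᶜ x₀)) ∧ᶜ ap₁ oracleᶜ x₀)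
                    admissible (λ _ _ → refl)

cellCheckᶜ : CFun 2
cellCheckᶜ = cast₂ P (λ α j c → cellCheck α c j) (λ _ _ _ → refl)
  where
  P : CFun 2
  P = tailsᶜ x₀ x₁ ⇒ᶜ ap₁ admissibleᶜ (entryᶜ x₁ x₀)
        ∧ᶜ (tailsᶜ (rightCellᶜ x₀) x₁ ⇒ᶜ rightᶜ (entryᶜ x₁ x₀) ==ᶜ leftᶜ (entryᶜ x₁ (rightCellᶜ x₀)))
        ∧ᶜ (tailsᶜ (upCellᶜ x₀) x₁ ⇒ᶜ upᶜ (entryᶜ x₁ x₀) ==ᶜ bottomᶜ (entryᶜ x₁ (upCellᶜ x₀)))

partialTilingsᶜ : CFun 1
partialTilingsᶜ = cast₁ (boolᶜ (ap₂ (allBelowᶜ cellCheckᶜ) x₀ x₀)) partialTilings (λ _ _ → refl)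

tilingCode : (ℤ → ℤ → Tile) → Baire
tilingCode f j = tileCode (f (column j) (row j))

tilingOf : Baire → ℤ → ℤ → Tile
tilingOf y x z = decodeTile (y (codeℤ² x z))

decodeTile-tilingCode : ∀ f j → decodeTile (tilingCode f j) ≡ f (column j) (row j)
decodeTile-tilingCode f j = decodeTile-tileCode (f (column j) (row j))

tiling⇒locallyTiled : ∀ {p S f} → δ TileSets p S → IsTiling S f → LocallyTiled p (tilingCode f)
tiling⇒locallyTiled {p} {S} {f} (_ , p-names-S) (f∈S , f-right , f-up) j =
  admissible-t , matches-right , matches-up
  where
  open ≡-Reasoning
  t : Tile
  t = f (column j) (row j)
  admissible-t : Admissible p (tileCode t)
  admissible-t = ∧ₙ-intro (==-intro (cong tileCode (sym (decodeTile-tileCode t))))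
                          (≡1⇒holds (Equivalence.to (p-names-S t) (f∈S (column j) (row j))))
  matches-right : HMatch (tilingCode f) j
  matches-right = begin
    right (decodeTile (tilingCode f j))                   ≡⟨ cong right (decodeTile-tilingCode f j) ⟩
    right t                                               ≡⟨ f-right (column j) (row j) ⟩
    left (f (ℤ.suc (column j)) (row j))                   ≡⟨ cong left (sym (cong₂ f (column-rightCell j) (row-rightCell j))) ⟩
    left (f (column (rightCell j)) (row (rightCell j)))   ≡⟨ cong left (sym (decodeTile-tilingCode f (rightCell j))) ⟩
    left (decodeTile (tilingCode f (rightCell j)))        ∎
  matches-up : VMatch (tilingCode f) j
  matches-up = begin
    up (decodeTile (tilingCode f j))                      ≡⟨ cong up (decodeTile-tilingCode f j) ⟩
    up t                                                  ≡⟨ f-up (column j) (row j) ⟩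
    bottom (f (column j) (ℤ.suc (row j)))                 ≡⟨ cong bottom (sym (cong₂ f (column-upCell j) (row-upCell j))) ⟩
    bottom (f (column (upCell j)) (row (upCell j)))       ≡⟨ cong bottom (sym (decodeTile-tilingCode f (upCell j))) ⟩
    bottom (decodeTile (tilingCode f (upCell j)))         ∎

admissible⇒tileCode : ∀ p {v} → Admissible p v → v ≡ tileCode (decodeTile v)
admissible⇒tileCode p adm = ==-sound (∧ₙ-elimˡ adm)

admissible⇒member : ∀ p {v} → IsChar p → Admissible p v → p (tileCode (decodeTile v)) ≡ 1
admissible⇒member p {v} p-char adm =
  trans (cong p (sym (admissible⇒tileCode p adm))) (holds⇒≡1 p-char v (∧ₙ-elimʳ {v == tileCode (decodeTile v)} adm))

locallyTiled⇒names : ∀ p {y} → LocallyTiled p y → δ Tilings y (tilingOf y)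
locallyTiled⇒names p tiled x z = admissible⇒tileCode p (proj₁ (tiled (codeℤ² x z)))

locallyTiled⇒tiling : ∀ {p S y} → δ TileSets p S → LocallyTiled p y → IsTiling S (tilingOf y)
locallyTiled⇒tiling {p} {S} {y} (p-char , p-names-S) tiled = tile∈S , tiles-right , tiles-up
  where
  tile∈S : ∀ x z → S (tilingOf y x z)
  tile∈S x z = Equivalence.from (p-names-S (tilingOf y x z)) (admissible⇒member p p-char (proj₁ (tiled (codeℤ² x z))))
  tiles-right : ∀ x z → right (tilingOf y x z) ≡ left (tilingOf y (ℤ.suc x) z)
  tiles-right x z = trans (proj₁ (proj₂ (tiled (codeℤ² x z)))) (cong (left ∘ decodeTile ∘ y) (rightCell-codeℤ² x z))
  tiles-up : ∀ x z → up (tilingOf y x z) ≡ bottom (tilingOf y x (ℤ.suc z))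
  tiles-up x z = trans (proj₂ (proj₂ (tiled (codeℤ² x z)))) (cong (bottom ∘ decodeTile ∘ y) (upCell-codeℤ² x z))

CT≤C-Baire : CT ≤sW C-Baire
CT≤C-Baire = sW-reduction CT C-Baire partialTilingsᶜ oracleᶜ reduce
  where
  reduce : NameReduction CT C-Baire partialTilingsᶜ oracleᶜ
  reduce p S p-names-S (f , f-tiles) =
    Path (partialTilings p) , (partialTilings-tree p , λ _ → mk⇔ id id) ,
    (tilingCode f , locallyTiled⇒path p _ (tiling⇒locallyTiled p-names-S f-tiles)) , back
    where
    back : ∀ q y → (∀ n → q n ≡ y n) → Path (partialTilings p) y →
           Σ (ℤ → ℤ → Tile) λ g → δ Tilings q g × IsTiling S g
    back q y q≡y path = tilingOf y , (λ x z → trans (q≡y (codeℤ² x z)) (locallyTiled⇒names p tiled x z)) ,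
                        locallyTiled⇒tiling p-names-S tiled
      where
      tiled : LocallyTiled p y
      tiled = path⇒locallyTiled p y path

-- Closed choice reduces to CT

-- Colours are pairs ⟨i , a⟩ of the code i of a column index and the code a of a reversed sequence.
record Transition (p : Baire) (i a i′ b : ℕ) : Set where
  field
    index-suc : i′ ≡ sucCode i
    extend    : parity i ≡ 0 → b ≡ consCode (headCode b) a × Holds (p (reverseCode b))
    blank     : Holds (parity i) → a ≡ 0 × b ≡ 0

transition : Baire → ℕ → ℕ → ℕ → ℕ → ℕ
transition p i a i′ b =
  (i′ == sucCode i) ∧ₙ ifz (parity i) (b == consCode (headCode b) a ∧ₙ p (reverseCode b)) (a == 0 ∧ₙ b == 0)

transition-pair : ∀ p i a i′ b →
  transition p (unpair₁ (pair i a)) (unpair₂ (pair i a)) (unpair₁ (pair i′ b)) (unpair₂ (pair i′ b)) ≡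
  transition p i a i′ b
transition-pair p i a i′ b =
  trans (cong₂ (λ i a → transition p i a (unpair₁ (pair i′ b)) (unpair₂ (pair i′ b)))
               (unpair₁-pair i a) (unpair₂-pair i a))
        (cong₂ (transition p i a) (unpair₁-pair i′ b) (unpair₂-pair i′ b))

transition-sound : ∀ p i a i′ b → Holds (transition p i a i′ b) → Transition p i a i′ b
transition-sound p i a i′ b h with parity i in par | ∧ₙ-elimʳ {i′ == sucCode i} h
... | zero  | even = record
  { index-suc = ==-sound (∧ₙ-elimˡ h)
  ; extend    = λ _ → ==-sound (∧ₙ-elimˡ even) , ∧ₙ-elimʳ {b == consCode (headCode b) a} even
  ; blank     = λ odd → ⊥-elim (odd par)
  }
... | suc _ | odd = record
  { index-suc = ==-sound (∧ₙ-elimˡ h)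
  ; extend    = λ even → ⊥-elim (0≢1+n (trans (sym even) par))
  ; blank     = λ _ → ==-sound (∧ₙ-elimˡ odd) , ==-sound (∧ₙ-elimʳ {a == 0} odd)
  }

transition-complete : ∀ p i a i′ b → Transition p i a i′ b → Holds (transition p i a i′ b)
transition-complete p i a i′ b tr = ∧ₙ-intro (==-intro (Transition.index-suc tr)) (by-parity (parity i) refl)
  where
  by-parity : ∀ c → parity i ≡ c →
              Holds (ifz c (b == consCode (headCode b) a ∧ₙ p (reverseCode b)) (a == 0 ∧ₙ b == 0))
  by-parity zero even with Transition.extend tr even
  ... | extends , holds = ∧ₙ-intro (==-intro extends) holds
  by-parity (suc _) odd with Transition.blank tr (λ par≡0 → 0≢1+n (trans (sym par≡0) odd))
  ... | a≡0 , b≡0 = ∧ₙ-intro (==-intro a≡0) (==-intro b≡0)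

TileTransition : Baire → Tile → Set
TileTransition p t = Transition p (unpair₁ (left t)) (unpair₂ (left t)) (unpair₁ (right t)) (unpair₂ (right t))

tileTransition : Baire → Tile → ℕ
tileTransition p t = transition p (unpair₁ (left t)) (unpair₂ (left t)) (unpair₁ (right t)) (unpair₂ (right t))

chainTile : Baire → ℕ → ℕ
chainTile p v =
  (v == tileCode ⟨ left (decodeTile v) , 0 , right (decodeTile v) , 0 ⟩) ∧ₙ tileTransition p (decodeTile v)

chainTile-tileCode : ∀ p t → chainTile p (tileCode t) ≡
                     ((tileCode t == tileCode ⟨ left t , 0 , right t , 0 ⟩) ∧ₙ tileTransition p t)
chainTile-tileCode p t =
  cong (λ u → (tileCode t == tileCode ⟨ left u , 0 , right u , 0 ⟩) ∧ₙ tileTransition p u) (decodeTile-tileCode t)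

chainTile-sound : ∀ p t → Holds (chainTile p (tileCode t)) → TileTransition p t
chainTile-sound p t h = transition-sound p _ _ _ _
  (∧ₙ-elimʳ {tileCode t == tileCode ⟨ left t , 0 , right t , 0 ⟩} (subst Holds (chainTile-tileCode p t) h))

chainTile-complete : ∀ p i a i′ b → Transition p i a i′ b →
                     Holds (chainTile p (tileCode ⟨ pair i a , 0 , pair i′ b , 0 ⟩))
chainTile-complete p i a i′ b tr = subst Holds (sym (chainTile-tileCode p t))
  (∧ₙ-intro (==-intro {tileCode t} refl)
            (subst Holds (sym (transition-pair p i a i′ b)) (transition-complete p i a i′ b tr)))
  where
  t : Tile
  t = ⟨ pair i a , 0 , pair i′ b , 0 ⟩

transitionᶜ : ∀ {n} → CFun n → CFun n → CFun n → CFun n → CFun n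
transitionᶜ i a i′ b =
  (i′ ==ᶜ ap₁ sucCodeᶜ i) ∧ᶜ ifᶜ (ap₁ parityᶜ i)
                                (b ==ᶜ consCodeᶜ (ap₁ headᶜ b) a ∧ᶜ ap₁ oracleᶜ (ap₁ reverseCodeᶜ b))
                                (a ==ᶜ constᶜ 0 ∧ᶜ b ==ᶜ constᶜ 0)

chainTilesᶜ : CFun 1
chainTilesᶜ = cast₁ (boolᶜ ((x₀ ==ᶜ tileCodeᶜ l (constᶜ 0) r (constᶜ 0))
                            ∧ᶜ transitionᶜ (ap₁ unpair₁ᶜ l) (ap₁ unpair₂ᶜ l) (ap₁ unpair₁ᶜ r) (ap₁ unpair₂ᶜ r)))
                    (λ p v → bool (chainTile p v)) (λ _ _ → refl)
  where
  l r : CFun 1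
  l = leftᶜ x₀
  r = rightᶜ x₀

history : Baire → ℤ → ℕ
history z (+ n)      = code (reverse (prefix z n))
history z -[1+ _ ]   = 0

columnTile : Baire → ℤ → Tile
columnTile z x = ⟨ pair (codeℤ x) (history z x) , 0 , pair (codeℤ (ℤ.suc x)) (history z (ℤ.suc x)) , 0 ⟩

history-transition : ∀ p z → Path p z → ∀ x →
                     Transition p (codeℤ x) (history z x) (codeℤ (ℤ.suc x)) (history z (ℤ.suc x))
history-transition p z path x = record
  { index-suc = sym (sucCode-codeℤ x)
  ; extend    = extend x
  ; blank     = blank x
  }
  where
  extend : ∀ x → parity (codeℤ x) ≡ 0 →
           history z (ℤ.suc x) ≡ consCode (headCode (history z (ℤ.suc x))) (history z x) ×
           Holds (p (reverseCode (history z (ℤ.suc x))))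
  extend (+ n) _ =
    trans extends (cong (λ w → consCode w (history z (+ n)))
                        (sym (trans (cong headCode extends) (headCode-code (z n) _)))) ,
    ≡1⇒holds (trans (cong p (reverseCode-reversed-prefix z (suc n))) (path (suc n)))
    where
    extends : history z (+ suc n) ≡ consCode (z n) (history z (+ n))
    extends = cong code (reverse-prefix-suc z n)
  extend -[1+ m ] even = ⊥-elim (0≢1+n (trans (sym even) (proj₁ (double-odd m))))
  blank : ∀ x → Holds (parity (codeℤ x)) → history z x ≡ 0 × history z (ℤ.suc x) ≡ 0
  blank (+ n) odd = ⊥-elim (odd (proj₁ (double-even n)))
  blank -[1+ zero ] _  = refl , refl
  blank -[1+ suc m ] _ = refl , refl

ChainTiles : Baire → Tile → Set
ChainTiles p t = bool (chainTile p (tileCode t)) ≡ 1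

columnTiling : ∀ p z → Path p z → IsTiling (ChainTiles p) (λ x _ → columnTile z x)
columnTiling p z path =
  (λ x _ → holds⇒bool≡1 (chainTile-complete p _ _ _ _ (history-transition p z path x))) ,
  (λ _ _ → refl) ,
  (λ _ _ → refl)

-- The origin tile tells the index c of column 0, so index + n sits in column + n - decodeℤ c; the
-- n-th entry of the path is the entry that this column appends in row 0.
readPath : Baire → Baire
readPath q n =
  headCode (unpair₂ (right (decodeTile (q (pair (offsetCode (unpair₁ (left (decodeTile (q 0)))) n) 0)))))

readPathᶜ : CFun 1
readPathᶜ = cast₁ (ap₁ headᶜ (ap₁ unpair₂ᶜ (rightᶜ (ap₁ oracleᶜ (ap₂ pairᶜ (offsetCodeᶜ origin x₀) (constᶜ 0))))))
                  readPath (λ _ _ → refl)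
  where
  origin : CFun 1
  origin = ap₁ unpair₁ᶜ (leftᶜ (ap₁ oracleᶜ (constᶜ 0)))

module ReadTiling (p : Baire) (p-char : IsChar p) (p-root : p 0 ≡ 1)
                  (q : Baire) (g : ℤ → ℤ → Tile) (q-names-g : δ Tilings q g) (g-tiles : IsTiling (ChainTiles p) g) where

  open ≡-Reasoning

  leftColour rightColour : ℤ → ℕ
  leftColour x = left (g x 0ℤ)
  rightColour x = right (g x 0ℤ)

  transitionAt : ∀ x → TileTransition p (g x 0ℤ)
  transitionAt x = chainTile-sound p (g x 0ℤ) (bool≡1⇒holds (proj₁ g-tiles x 0ℤ))

  leftColour-suc : ∀ x → leftColour (ℤ.suc x) ≡ rightColour x
  leftColour-suc x = sym (proj₁ (proj₂ g-tiles) x 0ℤ)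

  indexCode : ℤ → ℕ
  indexCode x = unpair₁ (leftColour x)

  columnIndex : ℤ → ℤ
  columnIndex x = decodeℤ (indexCode x)

  columnIndex-translation : ∀ x → columnIndex x ≡ columnIndex 0ℤ ℤ.+ x
  columnIndex-translation = suc-equivariant⇒translation columnIndex λ x → begin
    decodeℤ (unpair₁ (leftColour (ℤ.suc x)))  ≡⟨ cong (decodeℤ ∘ unpair₁) (leftColour-suc x) ⟩
    decodeℤ (unpair₁ (rightColour x))         ≡⟨ cong decodeℤ (Transition.index-suc (transitionAt x)) ⟩
    decodeℤ (sucCode (indexCode x))           ≡⟨ decodeℤ-sucCode (indexCode x) ⟩
    ℤ.suc (columnIndex x)                     ∎

  position : ℕ → ℤ
  position n = + n ℤ.- columnIndex 0ℤ

  position-suc : ∀ n → position (suc n) ≡ ℤ.suc (position n)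
  position-suc n = ℤₚ.+-assoc 1ℤ (+ n) (ℤ.- columnIndex 0ℤ)

  indexCode-position : ∀ n → indexCode (position n) ≡ n + n
  indexCode-position n = begin
    indexCode (position n)                 ≡⟨ sym (codeℤ-decodeℤ (indexCode (position n))) ⟩
    codeℤ (columnIndex (position n))       ≡⟨ cong codeℤ (columnIndex-translation (position n)) ⟩
    codeℤ (columnIndex 0ℤ ℤ.+ position n)  ≡⟨ cong codeℤ (+-cancel-sub (columnIndex 0ℤ) (+ n)) ⟩
    n + n                                  ∎

  readPath-position : ∀ n → readPath q n ≡ headCode (unpair₂ (rightColour (position n)))
  readPath-position n = cong (headCode ∘ unpair₂ ∘ right) (begin
    decodeTile (q (pair (offsetCode (unpair₁ (left (decodeTile (q 0)))) n) 0))
      ≡⟨ cong (λ t → decodeTile (q (pair (offsetCode (unpair₁ (left t)) n) 0))) (names⇒decodeTile q g q-names-g 0ℤ 0ℤ) ⟩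
    decodeTile (q (pair (offsetCode (indexCode 0ℤ) n) 0))
      ≡⟨ cong (λ c → decodeTile (q (pair c 0))) (offsetCode-correct (indexCode 0ℤ) n) ⟩
    decodeTile (q (codeℤ² (position n) 0ℤ))
      ≡⟨ names⇒decodeTile q g q-names-g (position n) 0ℤ ⟩
    g (position n) 0ℤ
      ∎)

  historyAt : ℕ → ℕ
  historyAt n = unpair₂ (leftColour (position n))

  historyAt-suc : ∀ n → historyAt (suc n) ≡ unpair₂ (rightColour (position n))
  historyAt-suc n = trans (cong (unpair₂ ∘ leftColour) (position-suc n)) (cong unpair₂ (leftColour-suc (position n)))

  -- Column (position 0) is preceded by the column of index -1, which is odd, so its right history is empty.
  historyAt-zero : historyAt 0 ≡ 0
  historyAt-zero = begin
    unpair₂ (leftColour (position 0))  ≡⟨ cong (unpair₂ ∘ leftColour) (sym (ℤₚ.suc-pred (position 0))) ⟩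
    unpair₂ (leftColour (ℤ.suc w))     ≡⟨ cong unpair₂ (leftColour-suc w) ⟩
    unpair₂ (rightColour w)            ≡⟨ proj₂ (Transition.blank (transitionAt w) w-odd) ⟩
    0                                  ∎
    where
    w : ℤ
    w = ℤ.pred (position 0)
    indexCode-w : indexCode w ≡ 1
    indexCode-w = trans (sym (codeℤ-decodeℤ (indexCode w)))
                        (cong codeℤ (trans (columnIndex-translation w) (+-pred-cancel-sub (columnIndex 0ℤ))))
    w-odd : Holds (parity (indexCode w))
    w-odd = subst (Holds ∘ parity) (sym indexCode-w) λ ()

  rightHistory-extends : ∀ n → unpair₂ (rightColour (position n)) ≡ consCode (readPath q n) (historyAt n) ×
                               Holds (p (reverseCode (unpair₂ (rightColour (position n)))))
  rightHistory-extends n = trans (proj₁ extension) (cong (λ w → consCode w (historyAt n)) (sym (readPath-position n))) ,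
                           proj₂ extension
    where
    extension : unpair₂ (rightColour (position n)) ≡ consCode (headCode (unpair₂ (rightColour (position n)))) (historyAt n) ×
                Holds (p (reverseCode (unpair₂ (rightColour (position n)))))
    extension = Transition.extend (transitionAt (position n))
                                  (trans (cong parity (indexCode-position n)) (proj₁ (double-even n)))

  historyAt-prefix : ∀ n → historyAt n ≡ code (reverse (prefix (readPath q) n))
  historyAt-prefix = consCode-history (readPath q) historyAt historyAt-zero
                                      (λ n → trans (historyAt-suc n) (proj₁ (rightHistory-extends n)))

  path : Path p (readPath q)
  path zero = p-root
  path (suc n) = holds⇒≡1 p-char _ (subst (Holds ∘ p) reversed-history (proj₂ (rightHistory-extends n)))
    where
    reversed-history : reverseCode (unpair₂ (rightColour (position n))) ≡ code (prefix (readPath q) (suc n))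
    reversed-history = trans (cong reverseCode (trans (sym (historyAt-suc n)) (historyAt-prefix (suc n))))
                             (reverseCode-reversed-prefix (readPath q) (suc n))

C-Baire≤CT : C-Baire ≤sW CT
C-Baire≤CT = sW-reduction C-Baire CT chainTilesᶜ readPathᶜ reduce
  where
  reduce : NameReduction C-Baire CT chainTilesᶜ readPathᶜ
  reduce p A ((p-char , _) , p-names-A) (z , z∈A) =
    ChainTiles p , ((λ v → bool-char (chainTile p v)) , λ _ → mk⇔ id id) ,
    ((λ x _ → columnTile z x) , columnTiling p z z-path) , back
    where
    z-path : Path p z
    z-path = Equivalence.to (p-names-A z) z∈A
    back : ∀ q g → δ Tilings q g → IsTiling (ChainTiles p) g → Σ Baire λ y → (∀ n → readPath q n ≡ y n) × A y
    back q g q-names-g g-tiles =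
      readPath q , (λ _ → refl) ,
      Equivalence.from (p-names-A (readPath q)) (ReadTiling.path p p-char (z-path 0) q g q-names-g g-tiles)

mainTheorem10 : CT ≡sW C-Baire
mainTheorem10 = CT≤C-Baire , C-Baire≤CT
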